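{- Let $M \ge 2$ and $p \ge 1$ be integers, let $I=\{0,1,\dots,M^{p+1}-1\}$, and for $N \in \{1,\dots,M-1\}$ and $j \in \{0,\dots,M-1\}$ let $T_j(N) := \{ m \in I : \mathcal{B}_{M,N}(m) \equiv j \pmod M\}$. Then the sets $T_0(N),\dots,T_{M-1}(N)$ form a solution of the Prouhet–Tarry–Escott problem of degree $p$, i.e. $\sum_{m\in T_j(N)} m^k$ is independent of $j$ for every $k=0,1,\dots,p$, if and only if $\gcd(M,N)=1$. Furthermore, distinct values $N\in\{1,\dots,M-1\}$ with $\gcd(M,N)=1$ produce distinct partitions $(T_0(N),\dots,T_{M-1}(N))$, so this construction yields exactly $\varphi(M)$ distinct such solutions, where $\varphi$ is Euler's totient function.
   Context: For integers $M\ge 2$, $N \ge 1$ and $n\ge 0$ with base-$M$ expansion $n=\sum_{i\ge 0} d_i(n) M^i$, $d_i(n)\in\{0,\dots,M-1\}$, the base-shifting map is $\mathcal{B}_{M,N}(n) := \sum_{i\ge 0} d_i(n) N^i$. -}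

module Defs where

open import Data.Nat using (ℕ; zero; suc; _+_; _*_; _^_; _≤_; _<_; NonZero)
open import Data.Nat.DivMod using (_/_; _%_)
open import Data.Nat.Properties using (_≟_)
open import Data.List using (List; upTo; filter; map)
open import Data.Nat.ListAction using (sum)
open import Data.Product using (_×_)
open import Function.Bundles using (_⇔_)
open import Relation.Binary.PropositionalEquality using (_≡_)

-- Base-shifting map B_{M,N}(n) = Σ d_i(n) N^i, where d_i(n) are the
-- base-M digits of n.  Computed by recursion on fuel; fuel n suffices
-- for M ≥ 2 since n has at most n nonzero base-M digits.
Bfuel : (M : ℕ) .{{_ : NonZero M}} → ℕ → ℕ → ℕ → ℕ
Bfuel M zero    N n = 0
Bfuel M (suc f) N n = n % M + N * Bfuel M f N (n / M)

B : (M : ℕ) .{{_ : NonZero M}} → (N n : ℕ) → ℕ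
B M N n = Bfuel M n N n

I : (M p : ℕ) → List ℕ
I M p = upTo (M ^ suc p)

InT : (M : ℕ) .{{_ : NonZero M}} → (N j m : ℕ) → Set
InT M N j m = B M N m % M ≡ j

T : (M : ℕ) .{{_ : NonZero M}} → (p N j : ℕ) → List ℕ
T M p N j = filter (λ m → B M N m % M ≟ j) (I M p)

PowSum : (M : ℕ) .{{_ : NonZero M}} → (p N j k : ℕ) → ℕ
PowSum M p N j k = sum (map (λ m → m ^ k) (T M p N j))

IsPTE : (M : ℕ) .{{_ : NonZero M}} → (p N : ℕ) → Set
IsPTE M p N = ∀ k → k ≤ p → ∀ j j' → j < M → j' < M →
              PowSum M p N j k ≡ PowSum M p N j' k

SamePartition : (M : ℕ) .{{_ : NonZero M}} → (p N₁ N₂ : ℕ) → Set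
SamePartition M p N₁ N₂ = ∀ j → j < M → ∀ m → m < M ^ suc p →
                          (InT M N₁ j m ⇔ InT M N₂ j m)

-- Write m = x·M + d with d the last base-M digit, so that B(m) = d + N·B(x).  If gcd(M, N) = 1,
-- then d ↦ d + N·B(x) and s ↦ d + N·s both permute the residues mod M.  Writing
-- f(x·M + d) = f(x·M) + δ_d(x·M) with deg δ_d < deg f, induction on the number of digits shows
-- that Σ_{m ∈ T_j, m < M^q} f(m) does not depend on j whenever deg f < q; take f(m) = m^k.
-- If g = gcd(M, N) > 1, then in every block {x·M, …, x·M + M − 1} the member of T_0 has last
-- digit divisible by g, hence not M − 1, and its successor is the member of T_1; so
-- Σ_{T_1} m = Σ_{T_0} m + M^p.  Finally B(M) = N puts M into T_N(N), which separates the
-- partitions for different N.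

module Submission where

import Algebra.Properties.CommutativeSemigroup as CommSemigroupProperties
open import Data.Empty using (⊥-elim)
open import Data.List using (List; []; _∷_; applyUpTo; filter; map)
open import Data.Nat
open import Data.Nat.Coprimality using (Coprime; coprime-divisor; gcd≡1⇒coprime)
open import Data.Nat.DivMod
open import Data.Nat.Divisibility
open import Data.Nat.GCD using (gcd; gcd[m,n]∣m; gcd[m,n]∣n)
open import Data.Nat.ListAction using (sum)
open import Data.Nat.Properties
open import Data.Nat.Solver using (module +-*-Solver)
open import Data.Product using (∃-syntax; _×_; _,_; proj₁; proj₂)
open import Data.Sum using (inj₁; inj₂)
open import Function.Bundles using (_⇔_; mk⇔; Equivalence)
open import Relation.Binary.PropositionalEquality
open import Relation.Nullary using (¬_; Dec; yes; no; contradiction)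
open import Relation.Nullary.Decidable using (decidable-stable)

open import Defs

open CommSemigroupProperties +-commutativeSemigroup using (interchange)
open +-*-Solver using (solve; _:+_; _:*_; _:^_; _:=_; con)
open ≡-Reasoning

variable
  n : ℕ
  f g : ℕ → ℕ

∑ : ℕ → (ℕ → ℕ) → ℕ
∑ zero    f = 0
∑ (suc n) f = f 0 + ∑ n (λ i → f (suc i))

syntax ∑ n (λ i → e) = ∑[ i < n ] e

∑-cong : ∀ n → (∀ {i} → i < n → f i ≡ g i) → ∑ n f ≡ ∑ n g
∑-cong zero    eq = refl
∑-cong (suc n) eq = cong₂ _+_ (eq z<s) (∑-cong n (λ i<n → eq (s<s i<n)))

∑-zero : ∀ n → ∑[ i < n ] 0 ≡ 0
∑-zero zero    = refl
∑-zero (suc n) = ∑-zero n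

∑-const : ∀ n c → ∑[ i < n ] c ≡ n * c
∑-const zero    c = refl
∑-const (suc n) c = cong (c +_) (∑-const n c)

∑-distrib-+ : ∀ n → ∑[ i < n ] (f i + g i) ≡ ∑ n f + ∑ n g
∑-distrib-+ zero = refl
∑-distrib-+ {f = f} {g = g} (suc n) =
  trans (cong (f 0 + g 0 +_) (∑-distrib-+ n)) (interchange (f 0) (g 0) _ _)

∑-mono-≤ : ∀ n → (∀ {i} → i < n → f i ≤ g i) → ∑ n f ≤ ∑ n g
∑-mono-≤ zero    le = z≤n
∑-mono-≤ (suc n) le = +-mono-≤ (le z<s) (∑-mono-≤ n (λ i<n → le (s<s i<n)))

∑-++ : ∀ a b f → ∑ (a + b) f ≡ ∑ a f + ∑[ i < b ] f (a + i)
∑-++ zero    b f = refl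
∑-++ (suc a) b f = trans (cong (f 0 +_) (∑-++ a b (λ i → f (suc i)))) (sym (+-assoc (f 0) _ _))

∑-blocks : ∀ X M f → ∑ (X * M) f ≡ ∑[ x < X ] ∑[ d < M ] f (x * M + d)
∑-blocks zero    M f = refl
∑-blocks (suc X) M f = begin
  ∑ (M + X * M) f                                   ≡⟨ ∑-++ M (X * M) f ⟩
  ∑ M f + ∑[ i < X * M ] f (M + i)                  ≡⟨ cong (∑ M f +_) (∑-blocks X M _) ⟩
  ∑ M f + ∑[ x < X ] ∑[ d < M ] f (M + (x * M + d))
    ≡⟨ cong (∑ M f +_) (∑-cong X λ _ → ∑-cong M λ _ → cong f (sym (+-assoc M _ _))) ⟩
  ∑ M f + ∑[ x < X ] ∑[ d < M ] f (M + x * M + d)   ∎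

∑-swap : ∀ a b (h : ℕ → ℕ → ℕ) → ∑[ i < a ] ∑[ j < b ] h i j ≡ ∑[ j < b ] ∑[ i < a ] h i j
∑-swap zero    b h = sym (∑-zero b)
∑-swap (suc a) b h = trans (cong (∑[ j < b ] h 0 j +_) (∑-swap a b (λ i → h (suc i))))
                           (sym (∑-distrib-+ b))

ind : ∀ {A : Set} → Dec A → ℕ → ℕ
ind (yes _) v = v
ind (no _)  v = 0

ind-zero : ∀ {A : Set} (d : Dec A) → ind d 0 ≡ 0
ind-zero (yes _) = refl
ind-zero (no _)  = refl

ind-distrib-+ : ∀ {A : Set} (d : Dec A) x y → ind d (x + y) ≡ ind d x + ind d y
ind-distrib-+ (yes _) x y = refl
ind-distrib-+ (no _)  x y = refl

ind-comm : ∀ {A B : Set} (d : Dec A) (e : Dec B) x → ind d (ind e x) ≡ ind e (ind d x)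
ind-comm (yes _) (yes _) x = refl
ind-comm (yes _) (no _)  x = refl
ind-comm (no _)  (yes _) x = refl
ind-comm (no _)  (no _)  x = refl

∑-ind : ∀ {A : Set} n (d : Dec A) f → ∑[ i < n ] ind d (f i) ≡ ind d (∑ n f)
∑-ind n (yes _) f = refl
∑-ind n (no _)  f = ∑-zero n

∑-ind-none : {A : ℕ → Set} (P? : ∀ s → Dec (A s)) → (∀ {s} → s < n → ¬ A s) →
             ∑[ s < n ] ind (P? s) (f s) ≡ 0
∑-ind-none {zero}  P? none = refl
∑-ind-none {suc n} P? none with P? 0
... | yes a = ⊥-elim (none z<s a)
... | no _  = ∑-ind-none (λ s → P? (suc s)) (λ s<n → none (s<s s<n))

∑-ind-unique : {A : ℕ → Set} (P? : ∀ s → Dec (A s)) → ∀ {s₀} → s₀ < n → A s₀ →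
               (∀ {s} → s < n → A s → s ≡ s₀) → ∑[ s < n ] ind (P? s) (f s) ≡ f s₀
∑-ind-unique {suc n} P? {s₀} s₀<n a unique with P? 0
... | yes a₀ with refl ← unique z<s a₀ =
  trans (cong (_ +_) (∑-ind-none (λ s → P? (suc s)) (λ s<n as → 0≢1+n (sym (unique (s<s s<n) as)))))
        (+-identityʳ _)
∑-ind-unique {suc n} P? {zero}   s₀<n       a unique | no ¬a₀ = ⊥-elim (¬a₀ a)
∑-ind-unique {suc n} P? {suc s₀} (s<s s₀<n) a unique | no _   =
  ∑-ind-unique (λ s → P? (suc s)) s₀<n a (λ s<n as → suc-injective (unique (s<s s<n) as))

count≤1 : {A : ℕ → Set} (P? : ∀ s → Dec (A s)) →
          (∀ {s s'} → s < n → s' < n → A s → A s' → s ≡ s') → ∑[ s < n ] ind (P? s) 1 ≤ 1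
count≤1 {zero}  P? unique = z≤n
count≤1 {suc n} P? unique with P? 0
... | yes a₀ = ≤-reflexive (cong suc (∑-ind-none (λ s → P? (suc s))
                 (λ s<n as → 0≢1+n (unique z<s (s<s s<n) a₀ as))))
... | no _   = count≤1 (λ s → P? (suc s))
                 (λ s<n s'<n as as' → suc-injective (unique (s<s s<n) (s<s s'<n) as as'))

count≢0⇒∃ : {A : ℕ → Set} (P? : ∀ s → Dec (A s)) → ∑[ s < n ] ind (P? s) 1 ≢ 0 →
            ∃[ s ] s < n × A s
count≢0⇒∃ {zero}  P? count≢0 = ⊥-elim (count≢0 refl)
count≢0⇒∃ {suc n} P? count≢0 with P? 0
... | yes a₀ = 0 , z<s , a₀
... | no _ with count≢0⇒∃ (λ s → P? (suc s)) count≢0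
...   | s , s<n , as = suc s , s<s s<n , as

∑≡n⇒all≡1 : ∀ n → (∀ {i} → i < n → f i ≤ 1) → ∑ n f ≡ n → ∀ {i} → i < n → f i ≡ 1
∑≡n⇒all≡1 {f = f} (suc n) ≤1 total = at
  where
  tail≤n : ∑[ i < n ] f (suc i) ≤ n
  tail≤n = ≤-trans (∑-mono-≤ n (λ i<n → ≤1 (s<s i<n)))
                   (≤-reflexive (trans (∑-const n 1) (*-identityʳ n)))

  head≡1 : f 0 ≡ 1
  head≡1 = ≤-antisym (≤1 z<s) (+-cancelʳ-≤ n 1 (f 0)
             (≤-trans (≤-reflexive (sym total)) (+-monoʳ-≤ (f 0) tail≤n)))

  tail≡n : ∑[ i < n ] f (suc i) ≡ n
  tail≡n = +-cancelˡ-≡ 1 _ _ (trans (cong (_+ ∑[ i < n ] f (suc i)) (sym head≡1)) total)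

  at : ∀ {i} → i < suc n → f i ≡ 1
  at {zero}  _         = head≡1
  at {suc i} (s<s i<n) = ∑≡n⇒all≡1 n (λ i<n → ≤1 (s<s i<n)) tail≡n i<n

record Permutes (n : ℕ) (v : ℕ → ℕ) : Set where
  field
    bounded   : ∀ {s} → s < n → v s < n
    injective : ∀ {s s'} → s < n → s' < n → v s ≡ v s' → s ≡ s'

  -- Each value is hit at most once, and the n×n incidence table has exactly n entries.
  surjective : ∀ {j} → j < n → ∃[ s ] s < n × v s ≡ j
  surjective j<n = count≢0⇒∃ (λ s → v s ≟ _)
    (λ count≡0 → 0≢1+n (trans (sym count≡0) (∑≡n⇒all≡1 n count≤1′ total j<n)))
    where
    count≤1′ : ∀ {j} → j < n → ∑[ s < n ] ind (v s ≟ j) 1 ≤ 1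
    count≤1′ _ = count≤1 (λ s → v s ≟ _)
                   (λ s<n s'<n vs≡j vs'≡j → injective s<n s'<n (trans vs≡j (sym vs'≡j)))

    total : ∑[ j < n ] ∑[ s < n ] ind (v s ≟ j) 1 ≡ n
    total = begin
      ∑[ j < n ] ∑[ s < n ] ind (v s ≟ j) 1 ≡⟨ ∑-swap n n _ ⟩
      ∑[ s < n ] ∑[ j < n ] ind (v s ≟ j) 1
        ≡⟨ ∑-cong n (λ s<n → ∑-ind-unique (v _ ≟_) (bounded s<n) refl (λ _ → sym)) ⟩
      ∑[ s < n ] 1                          ≡⟨ ∑-const n 1 ⟩
      n * 1                                 ≡⟨ *-identityʳ n ⟩
      n                                     ∎

  ∑-ind-at : ∀ {s₀ j} → s₀ < n → v s₀ ≡ j → ∑[ s < n ] ind (v s ≟ j) (f s) ≡ f s₀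
  ∑-ind-at s₀<n vs₀≡j = ∑-ind-unique (λ s → v s ≟ _) s₀<n vs₀≡j
    (λ s<n vs≡j → injective s<n s₀<n (trans vs≡j (sym vs₀≡j)))

  ∑-ind-const : ∀ {j} → j < n → ∀ c → ∑[ s < n ] ind (v s ≟ j) c ≡ c
  ∑-ind-const j<n c with s₀ , s₀<n , vs₀≡j ← surjective j<n = ∑-ind-at s₀<n vs₀≡j

sum-map-applyUpTo : ∀ n (h g : ℕ → ℕ) → sum (map g (applyUpTo h n)) ≡ ∑[ i < n ] g (h i)
sum-map-applyUpTo zero    h g = refl
sum-map-applyUpTo (suc n) h g = cong (g (h 0) +_) (sum-map-applyUpTo n (λ i → h (suc i)) g)

sum-map-filter : {A : ℕ → Set} (P? : ∀ x → Dec (A x)) (g : ℕ → ℕ) (xs : List ℕ) →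
                 sum (map g (filter P? xs)) ≡ sum (map (λ x → ind (P? x) (g x)) xs)
sum-map-filter P? g []       = refl
sum-map-filter P? g (x ∷ xs) with P? x
... | yes _ = cong (g x +_) (sum-map-filter P? g xs)
... | no _  = sum-map-filter P? g xs

-- Poly n f: f is a polynomial function of degree < n (so Poly 0 f forces f = 0).
data Poly : ℕ → (ℕ → ℕ) → Set where
  poly-zero  : Poly n (λ _ → 0)
  poly-const : ∀ c → Poly (suc n) (λ _ → c)
  poly-+     : Poly n f → Poly n g → Poly n (λ x → f x + g x)
  poly-scale : ∀ c → Poly n f → Poly n (λ x → c * f x)
  poly-X*    : Poly n f → Poly (suc n) (λ x → x * f x)
  poly-ext   : (∀ x → f x ≡ g x) → Poly n f → Poly n g

poly-suc : Poly n f → Poly (suc n) f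
poly-suc poly-zero        = poly-zero
poly-suc (poly-const c)   = poly-const c
poly-suc (poly-+ p q)     = poly-+ (poly-suc p) (poly-suc q)
poly-suc (poly-scale c p) = poly-scale c (poly-suc p)
poly-suc (poly-X* p)      = poly-X* (poly-suc p)
poly-suc (poly-ext eq p)  = poly-ext eq (poly-suc p)

poly-^ : ∀ {k} → k < n → Poly n (λ x → x ^ k)
poly-^ {suc n} {zero}  _         = poly-const 1
poly-^ {suc n} {suc k} (s<s k<n) = poly-X* (poly-^ k<n)

poly-∘* : Poly n f → ∀ c → Poly n (λ x → f (x * c))
poly-∘* poly-zero        c = poly-zero
poly-∘* (poly-const k)   c = poly-const k
poly-∘* (poly-+ p q)     c = poly-+ (poly-∘* p c) (poly-∘* q c)
poly-∘* (poly-scale k p) c = poly-scale k (poly-∘* p c)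
poly-∘* (poly-X* {f = f} p) c =
  poly-ext (λ x → sym (*-assoc x c (f (x * c)))) (poly-X* (poly-scale c (poly-∘* p c)))
poly-∘* (poly-ext eq p)  c = poly-ext (λ x → eq (x * c)) (poly-∘* p c)

poly0⇒≡0 : Poly 0 f → ∀ x → f x ≡ 0
poly0⇒≡0 poly-zero        x = refl
poly0⇒≡0 (poly-+ p q)     x = cong₂ _+_ (poly0⇒≡0 p x) (poly0⇒≡0 q x)
poly0⇒≡0 (poly-scale c p) x = trans (cong (c *_) (poly0⇒≡0 p x)) (*-zeroʳ c)
poly0⇒≡0 (poly-ext eq p)  x = trans (sym (eq x)) (poly0⇒≡0 p x)

poly-shift : Poly (suc n) f → ∀ d → ∃[ g ] Poly n g × (∀ x → f (x + d) ≡ f x + g x)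
poly-shift (poly-const c) d = _ , poly-zero , λ _ → sym (+-identityʳ c)
poly-shift poly-zero      d = _ , poly-zero , λ _ → refl
poly-shift (poly-+ {f = f₁} {g = f₂} p q) d
  with g₁ , p₁ , eq₁ ← poly-shift p d | g₂ , p₂ , eq₂ ← poly-shift q d =
  _ , poly-+ p₁ p₂ ,
  λ x → trans (cong₂ _+_ (eq₁ x) (eq₂ x)) (interchange (f₁ x) (g₁ x) (f₂ x) (g₂ x))
poly-shift (poly-scale c p) d with g , pg , eq ← poly-shift p d =
  _ , poly-scale c pg , λ x → trans (cong (c *_) (eq x)) (*-distribˡ-+ c _ (g x))
poly-shift {zero} (poly-X* {f = f} p) d = _ , poly-zero , λ x → begin
  (x + d) * f (x + d) ≡⟨ cong ((x + d) *_) (poly0⇒≡0 p (x + d)) ⟩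
  (x + d) * 0         ≡⟨ *-zeroʳ (x + d) ⟩
  0                   ≡⟨ *-zeroʳ x ⟨
  x * 0               ≡⟨ cong (x *_) (poly0⇒≡0 p x) ⟨
  x * f x             ≡⟨ +-identityʳ _ ⟨
  x * f x + 0         ∎
poly-shift {suc n} (poly-X* {f = f} p) d with g , pg , eq ← poly-shift p d =
  _ , poly-+ (poly-+ (poly-X* pg) (poly-scale d p)) (poly-scale d (poly-suc pg)) ,
  λ x → trans (cong ((x + d) *_) (eq x))
    (solve 4 (λ x d fx gx → (x :+ d) :* (fx :+ gx) := x :* fx :+ (x :* gx :+ d :* fx :+ d :* gx))
           refl x d (f x) (g x))
poly-shift (poly-ext eq p) d with g , pg , eqg ← poly-shift p d =
  g , pg , λ x → trans (sym (eq (x + d))) (trans (eqg x) (cong (_+ g x) (eq x)))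

module Base (M : ℕ) .{{_ : NonZero M}} where

  [qM+d]%M≡d : ∀ q {d} → d < M → (q * M + d) % M ≡ d
  [qM+d]%M≡d q {d} d<M =
    trans (%-congˡ (+-comm (q * M) d)) (trans ([m+kn]%n≡m%n d q M) (m<n⇒m%n≡m d<M))

  [qM+d]/M≡q : ∀ q {d} → d < M → (q * M + d) / M ≡ q
  [qM+d]/M≡q q {d} d<M = begin
    (q * M + d) / M   ≡⟨ +-distrib-/-∣ˡ d (n∣m*n q) ⟩
    q * M / M + d / M ≡⟨ cong₂ _+_ (m*n/n≡m q M) (m<n⇒m/n≡0 d<M) ⟩
    q + 0             ≡⟨ +-identityʳ q ⟩
    q                 ∎

  [a+b*[x%M]]%M≡[a+b*x]%M : ∀ a b x → (a + b * (x % M)) % M ≡ (a + b * x) % M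
  [a+b*[x%M]]%M≡[a+b*x]%M a b x = begin
    (a + b * (x % M)) % M                   ≡⟨ [m+kn]%n≡m%n _ (b * (x / M)) M ⟨
    (a + b * (x % M) + b * (x / M) * M) % M ≡⟨ cong (_% M) (solve 5
      (λ a b r q m → a :+ b :* r :+ b :* q :* m := a :+ b :* (r :+ q :* m)) refl a b (x % M) (x / M) M) ⟩
    (a + b * (x % M + x / M * M)) % M       ≡⟨ cong (λ y → (a + b * y) % M) (m≡m%n+[m/n]*n x M) ⟨
    (a + b * x) % M                         ∎

  %≡%⇒∣∣-∣ : ∀ x y → x % M ≡ y % M → M ∣ ∣ x - y ∣
  %≡%⇒∣∣-∣ x y eq = divides ∣ x / M - y / M ∣ (begin
    ∣ x - y ∣
      ≡⟨ cong₂ ∣_-_∣ (m≡m%n+[m/n]*n x M) (m≡m%n+[m/n]*n y M) ⟩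
    ∣ x % M + x / M * M - y % M + y / M * M ∣
      ≡⟨ cong (λ r → ∣ x % M + x / M * M - r + y / M * M ∣) eq ⟨
    ∣ x % M + x / M * M - x % M + y / M * M ∣ ≡⟨ ∣m+n-m+o∣≡∣n-o∣ (x % M) _ _ ⟩
    ∣ x / M * M - y / M * M ∣                 ≡⟨ *-distribʳ-∣-∣ M (x / M) (y / M) ⟨
    ∣ x / M - y / M ∣ * M                     ∎)

  ∣∣-∣⇒≡ : ∀ {s s'} → s < M → s' < M → M ∣ ∣ s - s' ∣ → s ≡ s'
  ∣∣-∣⇒≡ {s} {s'} s<M s'<M M∣ =
    ∣m-n∣≡0⇒m≡n (multiple<M⇒≡0 M∣ (≤-<-trans (∣m-n∣≤m⊔n s s') (⊔-lub s<M s'<M)))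
    where
    multiple<M⇒≡0 : ∀ {z} → M ∣ z → z < M → z ≡ 0
    multiple<M⇒≡0 {zero}  _   _   = refl
    multiple<M⇒≡0 {suc z} M∣z z<M = contradiction M∣z (>⇒∤ z<M)

  shift-permutes : ∀ r → Permutes M (λ d → (d + r) % M)
  shift-permutes r = record
    { bounded   = λ {d} _ → m%n<n (d + r) M
    ; injective = λ {d} {d'} d<M d'<M eq → ∣∣-∣⇒≡ d<M d'<M (subst (M ∣_)
        (trans (cong₂ ∣_-_∣ (+-comm d r) (+-comm d' r)) (∣m+n-m+o∣≡∣n-o∣ r d d'))
        (%≡%⇒∣∣-∣ _ _ eq))
    }

  affine-permutes : ∀ a {b} → Coprime M b → Permutes M (λ s → (a + b * s) % M)
  affine-permutes a {b} cop = record
    { bounded   = λ {s} _ → m%n<n (a + b * s) M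
    ; injective = λ {s} {s'} s<M s'<M eq → ∣∣-∣⇒≡ s<M s'<M (coprime-divisor cop (subst (M ∣_)
        (trans (∣m+n-m+o∣≡∣n-o∣ a (b * s) (b * s')) (sym (*-distribˡ-∣-∣ b s s')))
        (%≡%⇒∣∣-∣ _ _ eq)))
    }

  module BaseShift (1<M : 1 < M) (N : ℕ) where

    0<M : 0 < M
    0<M = <-trans z<s 1<M

    n/M≤pred : ∀ {n f} → n ≤ suc f → n / M ≤ f
    n/M≤pred {zero}  _     = ≤-trans (≤-reflexive (0/n≡0 M)) z≤n
    n/M≤pred {suc n} n≤1+f = <⇒≤pred (<-≤-trans (m/n<m (suc n) M 1<M) n≤1+f)

    Bfuel-suc : ∀ {f n} → n ≤ f → Bfuel M (suc f) N n ≡ Bfuel M f N n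
    Bfuel-suc {zero}  z≤n   = cong₂ _+_ (m<n⇒m%n≡m 0<M) (*-zeroʳ N)
    Bfuel-suc {suc f} n≤1+f = cong (λ b → _ % M + N * b) (Bfuel-suc (n/M≤pred n≤1+f))

    Bfuel≡B : ∀ {f n} → n ≤ f → Bfuel M f N n ≡ B M N n
    Bfuel≡B {zero}  z≤n   = refl
    Bfuel≡B {suc f} n≤1+f with m≤n⇒m<n∨m≡n n≤1+f
    ... | inj₁ (s≤s n≤f) = trans (Bfuel-suc n≤f) (Bfuel≡B n≤f)
    ... | inj₂ refl      = refl

    B-step : ∀ n → B M N n ≡ n % M + N * B M N (n / M)
    B-step zero    = sym (trans (cong (λ m → 0 % M + N * B M N m) (0/n≡0 M))
                                (Bfuel-suc {zero} z≤n))
    B-step (suc n) = cong (λ b → suc n % M + N * b) (Bfuel≡B (n/M≤pred ≤-refl))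

    B-digit : ∀ q {d} → d < M → B M N (q * M + d) ≡ d + N * B M N q
    B-digit q d<M = trans (B-step _)
      (cong₂ (λ r x → r + N * B M N x) ([qM+d]%M≡d q d<M) ([qM+d]/M≡q q d<M))

    B-M≡N : B M N M ≡ N
    B-M≡N = begin
      B M N M               ≡⟨ cong (B M N) (trans (+-identityʳ (1 * M)) (*-identityˡ M)) ⟨
      B M N (1 * M + 0)     ≡⟨ B-digit 1 0<M ⟩
      N * B M N 1           ≡⟨ cong (N *_) (B-digit 0 1<M) ⟩
      N * (1 + N * 0)       ≡⟨ solve 1 (λ n → n :* (con 1 :+ n :* con 0) := n) refl N ⟩
      N                     ∎

    sumT : ℕ → ℕ → (ℕ → ℕ) → ℕ
    sumT q j f = ∑[ x < M ^ q ] ind (B M N x % M ≟ j) (f x)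

    PowSum≡sumT : ∀ p j k → PowSum M p N j k ≡ sumT (suc p) j (_^ k)
    PowSum≡sumT p j k = trans (sum-map-filter (λ x → B M N x % M ≟ j) (_^ k) (I M p))
                              (sum-map-applyUpTo (M ^ suc p) (λ x → x) _)

    sumT-zero : ∀ q {j f} → (∀ x → f x ≡ 0) → sumT q j f ≡ 0
    sumT-zero q f≡0 =
      trans (∑-cong (M ^ q) (λ {x} _ → trans (cong (ind _) (f≡0 x)) (ind-zero _))) (∑-zero (M ^ q))

    sumT-blocks : ∀ q j f → sumT (suc q) j f ≡
      ∑[ x < M ^ q ] ∑[ d < M ] ind ((d + N * B M N x) % M ≟ j) (f (x * M + d))
    sumT-blocks q j f = begin
      ∑ (M * M ^ q) F                         ≡⟨ cong (λ n → ∑ n F) (*-comm M (M ^ q)) ⟩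
      ∑ (M ^ q * M) F                         ≡⟨ ∑-blocks (M ^ q) M F ⟩
      ∑[ x < M ^ q ] ∑[ d < M ] F (x * M + d)
        ≡⟨ ∑-cong (M ^ q) (λ {x} _ → ∑-cong M (λ {d} d<M →
             cong (λ b → ind (b % M ≟ j) (f (x * M + d))) (B-digit x d<M))) ⟩
      ∑[ x < M ^ q ] ∑[ d < M ] ind ((d + N * B M N x) % M ≟ j) (f (x * M + d)) ∎
      where
      F : ℕ → ℕ
      F x = ind (B M N x % M ≟ j) (f x)

    module _ (coprime : Coprime M N) where

      -- Group the x by s = B x % M, which alone decides the residue of d + N * B x.
      sumT-regroup : ∀ q h → (∀ {s} → s < M → sumT q s h ≡ sumT q 0 h) → ∀ d {j} → j < M →
                     ∑[ x < M ^ q ] ind ((d + N * B M N x) % M ≟ j) (h x) ≡ sumT q 0 h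
      sumT-regroup q h equi d {j} j<M = begin
        ∑[ x < M ^ q ] ind ((d + N * B M N x) % M ≟ j) (h x)
          ≡⟨ ∑-cong (M ^ q) (λ {x} _ → sym (trans
               (∑-ind-unique (B M N x % M ≟_) (m%n<n (B M N x) M) refl (λ _ → sym))
               (cong (λ r → ind (r ≟ j) (h x)) ([a+b*[x%M]]%M≡[a+b*x]%M d N (B M N x))))) ⟩
        ∑[ x < M ^ q ] ∑[ s < M ] ind (B M N x % M ≟ s) (ind ((d + N * s) % M ≟ j) (h x))
          ≡⟨ ∑-swap (M ^ q) M _ ⟩
        ∑[ s < M ] ∑[ x < M ^ q ] ind (B M N x % M ≟ s) (ind ((d + N * s) % M ≟ j) (h x))
          ≡⟨ ∑-cong M (λ {s} _ → trans
               (∑-cong (M ^ q) (λ {x} _ → ind-comm (B M N x % M ≟ s) ((d + N * s) % M ≟ j) (h x)))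
               (∑-ind (M ^ q) ((d + N * s) % M ≟ j) _)) ⟩
        ∑[ s < M ] ind ((d + N * s) % M ≟ j) (sumT q s h)
          ≡⟨ ∑-cong M (λ {s} s<M → cong (ind ((d + N * s) % M ≟ j)) (equi s<M)) ⟩
        ∑[ s < M ] ind ((d + N * s) % M ≟ j) (sumT q 0 h)
          ≡⟨ Permutes.∑-ind-const (affine-permutes d coprime) j<M (sumT q 0 h) ⟩
        sumT q 0 h ∎

      sumT-suc : ∀ q {f} (δ : ℕ → ℕ → ℕ) → (∀ d x → f (x + d) ≡ f x + δ d x) →
                 (∀ d {s} → s < M → sumT q s (λ x → δ d (x * M)) ≡ sumT q 0 (λ x → δ d (x * M))) →
                 ∀ {j} → j < M →
                 sumT (suc q) j f ≡
                 ∑[ x < M ^ q ] f (x * M) + ∑[ d < M ] sumT q 0 (λ x → δ d (x * M))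
      sumT-suc q {f} δ shift equi {j} j<M = begin
        sumT (suc q) j f
          ≡⟨ sumT-blocks q j f ⟩
        ∑[ x < M ^ q ] ∑[ d < M ] ind (∈T? x d) (f (x * M + d))
          ≡⟨ ∑-cong (M ^ q) (λ {x} _ → trans (∑-cong M (λ {d} _ →
               trans (cong (ind (∈T? x d)) (shift d (x * M))) (ind-distrib-+ (∈T? x d) _ _)))
               (∑-distrib-+ M)) ⟩
        ∑[ x < M ^ q ] (∑[ d < M ] ind (∈T? x d) (f (x * M)) + ∑[ d < M ] ind (∈T? x d) (δ d (x * M)))
          ≡⟨ ∑-distrib-+ (M ^ q) ⟩
        ∑[ x < M ^ q ] ∑[ d < M ] ind (∈T? x d) (f (x * M)) +
        ∑[ x < M ^ q ] ∑[ d < M ] ind (∈T? x d) (δ d (x * M))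
          ≡⟨ cong₂ _+_ (∑-cong (M ^ q) (λ {x} _ →
                          Permutes.∑-ind-const (shift-permutes (N * B M N x)) j<M (f (x * M))))
                       (∑-swap (M ^ q) M _) ⟩
        ∑[ x < M ^ q ] f (x * M) + ∑[ d < M ] ∑[ x < M ^ q ] ind (∈T? x d) (δ d (x * M))
          ≡⟨ cong (_ +_) (∑-cong M (λ {d} _ → sumT-regroup q _ (equi d) d j<M)) ⟩
        ∑[ x < M ^ q ] f (x * M) + ∑[ d < M ] sumT q 0 (λ x → δ d (x * M)) ∎
        where
        ∈T? : ∀ x d → Dec ((d + N * B M N x) % M ≡ j)
        ∈T? x d = (d + N * B M N x) % M ≟ j

      equidistributed : ∀ q {f} → Poly q f → ∀ {j} → j < M → sumT q j f ≡ sumT q 0 f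
      equidistributed zero    p _   =
        trans (sumT-zero 0 (poly0⇒≡0 p)) (sym (sumT-zero 0 (poly0⇒≡0 p)))
      equidistributed (suc q) p j<M =
        trans (sumT-suc q δ shift equi j<M) (sym (sumT-suc q δ shift equi 0<M))
        where
        δ : ℕ → ℕ → ℕ
        δ d = proj₁ (poly-shift p d)

        shift : ∀ d x → _ ≡ _
        shift d = proj₂ (proj₂ (poly-shift p d))

        equi : ∀ d {s} → s < M → sumT q s (λ x → δ d (x * M)) ≡ sumT q 0 (λ x → δ d (x * M))
        equi d = equidistributed q (poly-∘* (proj₁ (proj₂ (poly-shift p d))) M)

      coprime⇒PTE : ∀ p → IsPTE M p N
      coprime⇒PTE p k k≤p j j' j<M j'<M = begin
        PowSum M p N j k          ≡⟨ PowSum≡sumT p j k ⟩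
        sumT (suc p) j (_^ k)     ≡⟨ equidistributed (suc p) (poly-^ (s≤s k≤p)) j<M ⟩
        sumT (suc p) 0 (_^ k)     ≡⟨ equidistributed (suc p) (poly-^ (s≤s k≤p)) j'<M ⟨
        sumT (suc p) j' (_^ k)    ≡⟨ PowSum≡sumT p j' k ⟨
        PowSum M p N j' k         ∎

    module _ (gcd≢1 : gcd M N ≢ 1) where

      block-difference : ∀ r → gcd M N ∣ r → ∀ c →
        ∑[ d < M ] ind ((d + r) % M ≟ 1) ((c + d) ^ 1) ≡
        ∑[ d < M ] ind ((d + r) % M ≟ 0) ((c + d) ^ 1) + 1
      block-difference r g∣r c
        with d₀ , d₀<M , res₀ ← Permutes.surjective (shift-permutes r) 0<M = begin
        ∑[ d < M ] ind ((d + r) % M ≟ 1) ((c + d) ^ 1)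
          ≡⟨ Permutes.∑-ind-at (shift-permutes r) 1+d₀<M res₁ ⟩
        (c + suc d₀) ^ 1
          ≡⟨ solve 2 (λ c d → (c :+ (con 1 :+ d)) :^ 1 := (c :+ d) :^ 1 :+ con 1) refl c d₀ ⟩
        (c + d₀) ^ 1 + 1
          ≡⟨ cong (_+ 1) (Permutes.∑-ind-at (shift-permutes r) d₀<M res₀) ⟨
        ∑[ d < M ] ind ((d + r) % M ≟ 0) ((c + d) ^ 1) + 1 ∎
        where
        M∣d₀+r : M ∣ d₀ + r
        M∣d₀+r = m%n≡0⇒n∣m (d₀ + r) M res₀

        res₁ : (suc d₀ + r) % M ≡ 1
        res₁ = trans (%-remove-+ʳ 1 M∣d₀+r) (m<n⇒m%n≡m 1<M)

        -- gcd M N divides M, r and d₀ + r, hence d₀; so d₀ + 1 = M would force gcd M N ∣ 1.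
        1+d₀<M : suc d₀ < M
        1+d₀<M = ≤∧≢⇒< d₀<M λ 1+d₀≡M → gcd≢1 (∣1⇒≡1 (∣m+n∣m⇒∣n
          (subst (gcd M N ∣_) (trans (sym 1+d₀≡M) (+-comm 1 d₀)) (gcd[m,n]∣m M N))
          (∣m+n∣m⇒∣n (subst (gcd M N ∣_) (+-comm d₀ r) (∣-trans (gcd[m,n]∣m M N) M∣d₀+r)) g∣r)))

      sumT[1]≡sumT[0]+M^p : ∀ p → sumT (suc p) 1 (_^ 1) ≡ sumT (suc p) 0 (_^ 1) + M ^ p
      sumT[1]≡sumT[0]+M^p p = begin
        sumT (suc p) 1 (_^ 1)
          ≡⟨ sumT-blocks p 1 (_^ 1) ⟩
        ∑[ x < M ^ p ] ∑[ d < M ] ind ((d + N * B M N x) % M ≟ 1) ((x * M + d) ^ 1)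
          ≡⟨ ∑-cong (M ^ p) (λ {x} _ →
               block-difference (N * B M N x) (∣m⇒∣m*n (B M N x) (gcd[m,n]∣n M N)) (x * M)) ⟩
        ∑[ x < M ^ p ] (∑[ d < M ] ind ((d + N * B M N x) % M ≟ 0) ((x * M + d) ^ 1) + 1)
          ≡⟨ ∑-distrib-+ (M ^ p) ⟩
        ∑[ x < M ^ p ] ∑[ d < M ] ind ((d + N * B M N x) % M ≟ 0) ((x * M + d) ^ 1) + ∑[ x < M ^ p ] 1
          ≡⟨ cong₂ _+_ (sym (sumT-blocks p 0 (_^ 1))) (trans (∑-const (M ^ p) 1) (*-identityʳ (M ^ p))) ⟩
        sumT (suc p) 0 (_^ 1) + M ^ p ∎

      gcd≢1⇒¬PTE : ∀ p → 1 ≤ p → ¬ IsPTE M p N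
      gcd≢1⇒¬PTE p 1≤p pte = <⇒≢ (m^n>0 M p) (sym (+-cancelˡ-≡ _ (M ^ p) 0 (begin
        sumT (suc p) 0 (_^ 1) + M ^ p ≡⟨ sumT[1]≡sumT[0]+M^p p ⟨
        sumT (suc p) 1 (_^ 1)         ≡⟨ PowSum≡sumT p 1 1 ⟨
        PowSum M p N 1 1              ≡⟨ pte 1 1≤p 1 0 1<M 0<M ⟩
        PowSum M p N 0 1              ≡⟨ PowSum≡sumT p 0 1 ⟩
        sumT (suc p) 0 (_^ 1)         ≡⟨ +-identityʳ _ ⟨
        sumT (suc p) 0 (_^ 1) + 0     ∎)))

    B-M%M≡N : N < M → B M N M % M ≡ N
    B-M%M≡N N<M = trans (cong (_% M) B-M≡N) (m<n⇒m%n≡m N<M)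

  samePartition⇒≡ : 1 < M → ∀ p → 1 ≤ p → ∀ {N₁ N₂} → N₁ < M → N₂ < M →
                    SamePartition M p N₁ N₂ → N₁ ≡ N₂
  samePartition⇒≡ 1<M p 1≤p {N₁} {N₂} N₁<M N₂<M same =
    trans (sym (Equivalence.to (same N₁ N₁<M M M<M^[1+p]) (BaseShift.B-M%M≡N 1<M N₁ N₁<M)))
          (BaseShift.B-M%M≡N 1<M N₂ N₂<M)
    where
    M<M^[1+p] : M < M ^ suc p
    M<M^[1+p] = subst (_< M ^ suc p) (*-identityʳ M) (^-monoʳ-< M 1<M (s≤s 1≤p))

theorem3p2 : (M p : ℕ) .{{_ : NonZero M}} → 2 ≤ M → 1 ≤ p →
    ((N : ℕ) → 1 ≤ N → N < M → (IsPTE M p N ⇔ gcd M N ≡ 1))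
    × ((N₁ N₂ : ℕ) → 1 ≤ N₁ → N₁ < M → 1 ≤ N₂ → N₂ < M →
        gcd M N₁ ≡ 1 → gcd M N₂ ≡ 1 → N₁ ≢ N₂ →
        ¬ SamePartition M p N₁ N₂)
theorem3p2 M p 2≤M 1≤p = pte⇔coprime , distinct
  where
  open Base M

  pte⇔coprime : (N : ℕ) → 1 ≤ N → N < M → IsPTE M p N ⇔ gcd M N ≡ 1
  pte⇔coprime N _ _ = mk⇔
    (λ pte → decidable-stable (gcd M N ≟ 1) (λ gcd≢1 → gcd≢1⇒¬PTE gcd≢1 p 1≤p pte))
    (λ gcd≡1 → coprime⇒PTE (gcd≡1⇒coprime gcd≡1) p)
    where open BaseShift 2≤M N

  distinct : (N₁ N₂ : ℕ) → 1 ≤ N₁ → N₁ < M → 1 ≤ N₂ → N₂ < M →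
             gcd M N₁ ≡ 1 → gcd M N₂ ≡ 1 → N₁ ≢ N₂ → ¬ SamePartition M p N₁ N₂
  distinct N₁ N₂ _ N₁<M _ N₂<M _ _ N₁≢N₂ same =
    N₁≢N₂ (samePartition⇒≡ 2≤M p 1≤p N₁<M N₂<M same)
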